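{- Let $q$ be a prime power, $k\ge 1$, and let $C\subseteq\mathbb{F}_q^n$ be a linear code of dimension $k$ with codewords $c_1,\dots,c_{q^k}$ such that the set $\{\mathrm{wt}(c):c\in C\}$ of Hamming weights of its codewords (including $0$) has exactly $\frac{q^k-1}{q-1}+1$ elements. Suppose there exists a vector $x\in\mathbb{F}_q^n\setminus C$ such that $d(c_i,x)\neq d(c_j,x)$ for all $i\neq j$, where $d$ is the Hamming distance. Then there exists a linear code over $\mathbb{F}_q$ of dimension $k+1$ whose set of Hamming weights of codewords (including $0$) has exactly $\frac{q^{k+1}-1}{q-1}+1$ elements.
   Context: Hamming weight $\mathrm{wt}(v)$ = number of non-zero coordinates of $v$; Hamming distance $d(u,v)=\mathrm{wt}(u-v)$. -}

module Defs where

open import Data.Nat using (ℕ; zero; suc; _∸_; _^_; _/_)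
import Data.Nat as N
open import Data.Fin using (Fin)
import Data.Fin.Properties as FinP
open import Data.Vec using (Vec; []; _∷_; replicate; zipWith; foldr)
import Data.Vec
open import Data.Product using (Σ; ∃; _×_)
open import Data.Bool using (if_then_else_)
open import Function.Bundles using (_↔_)
open import Function.Definitions using (Injective)
open import Function.Properties.Inverse using (↔-sym; ↔⇒↣)
open import Algebra.Core using (Op₁; Op₂)
open import Algebra.Structures using (IsCommutativeRing)
open import Relation.Binary.PropositionalEquality using (_≡_; setoid)
open import Relation.Binary.Definitions using (DecidableEquality)
open import Relation.Nullary using (¬_; does)
open import Relation.Nullary.Decidable using (via-injection)

-- Its existence forces q to be a prime power, and F_q is
-- unique up to isomorphism, so quantifying over all such records is the
-- same as fixing F_q.
record FiniteField (q : ℕ) : Set₁ where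
  field
    Carrier : Set
    _+_ _*_ : Op₂ Carrier
    -_      : Op₁ Carrier
    0# 1#   : Carrier
    isCommutativeRing : IsCommutativeRing _≡_ _+_ _*_ -_ 0# 1#
    0≢1     : ¬ (0# ≡ 1#)
    inverse : ∀ x → ¬ (x ≡ 0#) → ∃ λ y → x * y ≡ 1#
    enum    : Fin q ↔ Carrier

  infixl 6 _+_
  infixl 7 _*_

  _≟_ : DecidableEquality Carrier
  _≟_ = via-injection (↔⇒↣ (↔-sym enum)) FinP._≟_

module _ {q : ℕ} (F : FiniteField q) where
  open FiniteField F

  Word : ℕ → Set
  Word n = Vec Carrier n

  0v : ∀ {n} → Word n
  0v = replicate _ 0#

  _⊕_ : ∀ {n} → Word n → Word n → Word n
  _⊕_ = zipWith _+_

  _⊖_ : ∀ {n} → Word n → Word n → Word n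
  u ⊖ v = zipWith (λ a b → a + (- b)) u v

  _·_ : ∀ {n} → Carrier → Word n → Word n
  a · v = Data.Vec.map (a *_) v

  wt : ∀ {n} → Word n → ℕ
  wt [] = 0
  wt (a ∷ v) = (if does (a ≟ 0#) then 0 else 1) N.+ wt v

  dist : ∀ {n} → Word n → Word n → ℕ
  dist u v = wt (u ⊖ v)

  GenMatrix : ℕ → ℕ → Set
  GenMatrix k n = Vec (Word n) k

  encode : ∀ {k n} → GenMatrix k n → Word k → Word n
  encode [] [] = 0v
  encode (g ∷ G) (a ∷ u) = (a · g) ⊕ encode G u

  LinIndep : ∀ {k n} → GenMatrix k n → Set
  LinIndep G = ∀ u → encode G u ≡ 0v → u ≡ 0v

  record LinearCode (n k : ℕ) : Set where
    field
      gen   : GenMatrix k n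
      indep : LinIndep gen

  open LinearCode public

  _∈C_ : ∀ {n k} → Word n → LinearCode n k → Set
  x ∈C C = ∃ λ u → encode (gen C) u ≡ x

  IsWeightOf : ∀ {n k} → LinearCode n k → ℕ → Set
  IsWeightOf C w = ∃ λ c → c ∈C C × wt c ≡ w

HasSize : (ℕ → Set) → ℕ → Set
HasSize P m = Σ (Fin m → ℕ) λ f →
  Injective _≡_ _≡_ f × (∀ i → P (f i)) × (∀ w → P w → ∃ λ i → f i ≡ w)

-- (q^k - 1)/(q - 1); for q ≥ 2 (always the case for a field) this is
-- literally the quotient; the value for q ≤ 1 is irrelevant.
θ : ℕ → ℕ → ℕ
θ (suc (suc r)) k = (suc (suc r) ^ k ∸ 1) / suc r
θ _ k = 0

-- Append to a generator matrix of C the row (1 … 1 | x) with n + 1 ones, padding the old rows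
-- with zeros.  The message (a, u) is then encoded as (a … a | a x + c) with c = encode u.  For
-- a = 0 its weight is wt c ≤ n; for a ≠ 0, rescaling by b with b a = −1 preserves the weight and
-- turns a x + c into b c − x, so the weight is n + 1 + d(b c, x) with b c ∈ C.  Hence the weights
-- of the new code are those of C together with the q^k values n + 1 + d(c, x), which are pairwise
-- distinct by hypothesis and all exceed n; and θ(k) + 1 + q^k = θ(k + 1) + 1.
module Submission where

open import Defs hiding (0v; _⊕_; _⊖_; _·_; wt; encode)
import Defs as D
open import Data.Nat using (ℕ; zero; suc; _+_; _∸_; _^_; _≥_; _≤_; z≤n; s≤s)
import Data.Nat as ℕ
import Data.Nat.Properties as NP
open import Data.Nat.DivMod using (_/_; +-distrib-/-∣ʳ; m*n/n≡m)
open import Data.Nat.Divisibility using (m∣m*n)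
open import Data.Fin using (Fin)
import Data.Fin.Properties as FP
open import Data.Vec using (Vec; []; _∷_; _++_; replicate; map)
import Data.Vec.Properties as VP
open import Data.Product using (∃; _×_; _,_)
open import Data.Product.Function.NonDependent.Propositional using (_×-↔_)
open import Data.Sum using (_⊎_; inj₁; inj₂; [_,_]; [_,_]′)
open import Data.Empty using (⊥-elim)
open import Data.Bool using (if_then_else_)
open import Function using (_∘_)
open import Function.Bundles using (_↔_; Inverse; Injection; mk↔ₛ′)
open import Function.Definitions using (Injective)
open import Function.Properties.Inverse using (↔-sym; ↔-trans; ↔⇒↣)
open import Level using (0ℓ)
open import Algebra.Bundles using (CommutativeRing)
open import Algebra.Structures using (IsCommutativeRing)
import Algebra.Properties.Ring as RingProperties
import Algebra.Properties.CommutativeSemigroup as CommutativeSemigroupProperties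
open import Relation.Binary.PropositionalEquality
  using (_≡_; _≢_; refl; sym; trans; cong; cong₂; subst; module ≡-Reasoning)
open import Relation.Nullary using (¬_; Dec; yes; no; does)

open CommutativeSemigroupProperties NP.+-commutativeSemigroup using (xy∙z≈xz∙y)

HasSize-via : ∀ {A : Set} {P : ℕ → Set} {m} → Fin m ↔ A → (f : A → ℕ) →
              Injective _≡_ _≡_ f → (∀ a → P (f a)) → (∀ w → P w → ∃ λ a → f a ≡ w) →
              HasSize P m
HasSize-via e f f-inj f∈P f-onto =
  f ∘ to , Injection.injective (↔⇒↣ e) ∘ f-inj , f∈P ∘ to , onto
  where
  open Inverse e
  onto : ∀ w → _ → ∃ λ i → f (to i) ≡ w
  onto w Pw with f-onto w Pw
  ... | a , fa≡w = from a , trans (cong f (strictlyInverseˡ a)) fa≡w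

HasSize-⊎ : ∀ {P Q : ℕ → Set} {m m′} → (∀ w → P w → ¬ Q w) →
            HasSize P m → HasSize Q m′ → HasSize (λ w → P w ⊎ Q w) (m + m′)
HasSize-⊎ {P} {Q} disjoint (f , f-inj , f∈P , f-onto) (g , g-inj , g∈Q , g-onto) =
  HasSize-via FP.+↔⊎ [ f , g ]′ h-inj [ inj₁ ∘ f∈P , inj₂ ∘ g∈Q ] h-onto
  where
  h-inj : Injective _≡_ _≡_ [ f , g ]′
  h-inj {inj₁ i} {inj₁ j} eq = cong inj₁ (f-inj eq)
  h-inj {inj₁ i} {inj₂ j} eq = ⊥-elim (disjoint _ (f∈P i) (subst Q (sym eq) (g∈Q j)))
  h-inj {inj₂ i} {inj₁ j} eq = ⊥-elim (disjoint _ (f∈P j) (subst Q eq (g∈Q i)))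
  h-inj {inj₂ i} {inj₂ j} eq = cong inj₂ (g-inj eq)
  h-onto : ∀ w → P w ⊎ Q w → ∃ λ i → [ f , g ]′ i ≡ w
  h-onto w (inj₁ Pw) with f-onto w Pw
  ... | i , fi≡w = inj₁ i , fi≡w
  h-onto w (inj₂ Qw) with g-onto w Qw
  ... | i , gi≡w = inj₂ i , gi≡w

HasSize-resp : ∀ {P Q : ℕ → Set} {m} → (∀ {w} → P w → Q w) → (∀ {w} → Q w → P w) →
               HasSize P m → HasSize Q m
HasSize-resp P⇒Q Q⇒P (f , f-inj , f∈P , f-onto) = f , f-inj , P⇒Q ∘ f∈P , λ w → f-onto w ∘ Q⇒P

×↔Vec : ∀ {A : Set} {k} → (A × Vec A k) ↔ Vec A (suc k)
×↔Vec = mk↔ₛ′ (λ (a , v) → a ∷ v) (λ { (a ∷ v) → a , v }) (λ { (a ∷ v) → refl }) (λ (a , v) → refl)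

Fin^↔Vec : ∀ {q} {A : Set} → Fin q ↔ A → ∀ k → Fin (q ^ k) ↔ Vec A k
Fin^↔Vec e zero    = mk↔ₛ′ (λ _ → []) (λ _ → Fin.zero) (λ { [] → refl }) (λ { Fin.zero → refl ; (Fin.suc ()) })
Fin^↔Vec e (suc k) = ↔-trans FP.*↔× (↔-trans (e ×-↔ Fin^↔Vec e k) ×↔Vec)

replicate-+ : ∀ {A : Set} m n (a : A) → replicate (m + n) a ≡ replicate m a ++ replicate n a
replicate-+ zero    n a = refl
replicate-+ (suc m) n a = cong (a ∷_) (replicate-+ m n a)

module _ {q : ℕ} (F : FiniteField q) where
  open FiniteField F renaming (_+_ to _+ᶠ_)
  open IsCommutativeRing isCommutativeRing
    using (+-identityˡ; +-identityʳ; +-comm; zeroˡ; zeroʳ; *-identityˡ; *-identityʳ; *-assoc; *-comm; distribˡ; -‿inverseʳ)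

  ring : CommutativeRing 0ℓ 0ℓ
  ring = record { isCommutativeRing = isCommutativeRing }

  open RingProperties (CommutativeRing.ring ring)
    using (-1*x≈-x; -‿distribˡ-*; -‿involutive; -0#≈0#; -‿+-comm; [y-z]x≈yx-zx; x∙y⁻¹≈ε⇒x≈y)
  open CommutativeSemigroupProperties (CommutativeRing.+-commutativeSemigroup ring)
    using (interchange)

  infixl 6 _⊕_ _⊖_
  infixr 7 _·_

  0v : ∀ {n} → Word F n
  0v = D.0v F

  _⊕_ _⊖_ : ∀ {n} → Word F n → Word F n → Word F n
  _⊕_ = D._⊕_ F
  _⊖_ = D._⊖_ F

  _·_ : ∀ {n} → Carrier → Word F n → Word F n
  _·_ = D._·_ F

  wt : ∀ {n} → Word F n → ℕ
  wt = D.wt F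

  encode : ∀ {k n} → GenMatrix F k n → Word F k → Word F n
  encode = D.encode F

  -1≢0 : - 1# ≢ 0#
  -1≢0 -1≡0 = 0≢1 (begin
    0#       ≡⟨ -0#≈0# ⟨
    - 0#     ≡⟨ cong -_ -1≡0 ⟨
    - (- 1#) ≡⟨ -‿involutive 1# ⟩
    1#       ∎)
    where open ≡-Reasoning

  inverse-of-negation : ∀ {a} → a ≢ 0# → ∃ λ b → b * a ≡ - 1#
  inverse-of-negation {a} a≢0 with inverse a a≢0
  ... | a⁻¹ , aa⁻¹≡1 = - a⁻¹ , (begin
    - a⁻¹ * a   ≡⟨ -‿distribˡ-* a⁻¹ a ⟨
    - (a⁻¹ * a) ≡⟨ cong -_ (trans (*-comm a⁻¹ a) aa⁻¹≡1) ⟩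
    - 1#        ∎)
    where open ≡-Reasoning

  *-nonzero : ∀ {a b} → a ≢ 0# → b ≢ 0# → a * b ≢ 0#
  *-nonzero {a} {b} a≢0 b≢0 ab≡0 with inverse a a≢0
  ... | a⁻¹ , aa⁻¹≡1 = b≢0 (begin
    b             ≡⟨ *-identityˡ b ⟨
    1# * b        ≡⟨ cong (_* b) (trans (*-comm a⁻¹ a) aa⁻¹≡1) ⟨
    a⁻¹ * a * b   ≡⟨ *-assoc a⁻¹ a b ⟩
    a⁻¹ * (a * b) ≡⟨ cong (a⁻¹ *_) ab≡0 ⟩
    a⁻¹ * 0#      ≡⟨ zeroʳ a⁻¹ ⟩
    0#            ∎)
    where open ≡-Reasoning

  ·-0v : ∀ {n} a → a · 0v {n} ≡ 0v
  ·-0v {n} a = trans (VP.map-replicate (a *_) 0# n) (cong (replicate n) (zeroʳ a))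

  1·v≡v : ∀ {n} (v : Word F n) → 1# · v ≡ v
  1·v≡v []      = refl
  1·v≡v (a ∷ v) = cong₂ _∷_ (*-identityˡ a) (1·v≡v v)

  0·x⊕v≡v : ∀ {n} (x v : Word F n) → 0# · x ⊕ v ≡ v
  0·x⊕v≡v []      []      = refl
  0·x⊕v≡v (b ∷ x) (a ∷ v) = cong₂ _∷_ (trans (cong (_+ᶠ a) (zeroˡ b)) (+-identityˡ a)) (0·x⊕v≡v x v)

  u⊖v≡0⇒u≡v : ∀ {n} (u v : Word F n) → u ⊖ v ≡ 0v → u ≡ v
  u⊖v≡0⇒u≡v []      []      _  = refl
  u⊖v≡0⇒u≡v (a ∷ u) (b ∷ v) eq =
    cong₂ _∷_ (x∙y⁻¹≈ε⇒x≈y a b (VP.∷-injectiveˡ eq)) (u⊖v≡0⇒u≡v u v (VP.∷-injectiveʳ eq))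

  ·-⊕-normalise : ∀ {n} {a b} → b * a ≡ - 1# → (x c : Word F n) → b · (a · x ⊕ c) ≡ b · c ⊖ x
  ·-⊕-normalise ba≡-1 []      []      = refl
  ·-⊕-normalise {a = a} {b} ba≡-1 (y ∷ x) (z ∷ c) = cong₂ _∷_ coordinate (·-⊕-normalise ba≡-1 x c)
    where
    open ≡-Reasoning
    coordinate : b * (a * y +ᶠ z) ≡ b * z +ᶠ - y
    coordinate = begin
      b * (a * y +ᶠ z)     ≡⟨ distribˡ b (a * y) z ⟩
      b * (a * y) +ᶠ b * z ≡⟨ cong (_+ᶠ b * z) (trans (sym (*-assoc b a y)) (cong (_* y) ba≡-1)) ⟩
      - 1# * y +ᶠ b * z    ≡⟨ cong (_+ᶠ b * z) (-1*x≈-x y) ⟩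
      - y +ᶠ b * z         ≡⟨ +-comm (- y) (b * z) ⟩
      b * z +ᶠ - y         ∎

  ·-distrib-⊕ : ∀ {n} a (u v : Word F n) → a · (u ⊕ v) ≡ a · u ⊕ a · v
  ·-distrib-⊕ a []      []      = refl
  ·-distrib-⊕ a (b ∷ u) (c ∷ v) = cong₂ _∷_ (distribˡ a b c) (·-distrib-⊕ a u v)

  ·-· : ∀ {n} a b (v : Word F n) → a · b · v ≡ (a * b) · v
  ·-· a b []      = refl
  ·-· a b (c ∷ v) = cong₂ _∷_ (sym (*-assoc a b c)) (·-· a b v)

  v⊖v≡0v : ∀ {n} (v : Word F n) → v ⊖ v ≡ 0v
  v⊖v≡0v []      = refl
  v⊖v≡0v (a ∷ v) = cong₂ _∷_ (-‿inverseʳ a) (v⊖v≡0v v)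

  ·⊕⊖-interchange : ∀ {n} a b (g p r : Word F n) → (a +ᶠ - b) · g ⊕ (p ⊖ r) ≡ (a · g ⊕ p) ⊖ (b · g ⊕ r)
  ·⊕⊖-interchange a b []      []      []      = refl
  ·⊕⊖-interchange a b (g ∷ gs) (p ∷ ps) (r ∷ rs) = cong₂ _∷_ coordinate (·⊕⊖-interchange a b gs ps rs)
    where
    open ≡-Reasoning
    coordinate : (a +ᶠ - b) * g +ᶠ (p +ᶠ - r) ≡ (a * g +ᶠ p) +ᶠ - (b * g +ᶠ r)
    coordinate = begin
      (a +ᶠ - b) * g +ᶠ (p +ᶠ - r)      ≡⟨ cong (_+ᶠ (p +ᶠ - r)) ([y-z]x≈yx-zx g a b) ⟩
      (a * g +ᶠ - (b * g)) +ᶠ (p +ᶠ - r) ≡⟨ interchange (a * g) (- (b * g)) p (- r) ⟩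
      (a * g +ᶠ p) +ᶠ (- (b * g) +ᶠ - r) ≡⟨ cong ((a * g +ᶠ p) +ᶠ_) (-‿+-comm (b * g) r) ⟩
      (a * g +ᶠ p) +ᶠ - (b * g +ᶠ r)     ∎

  ·-⊕-++ : ∀ m {n a b d} → a * b ≡ d → (y c : Word F n) →
           a · (replicate m b ++ y) ⊕ (replicate m 0# ++ c) ≡ replicate m d ++ (a · y ⊕ c)
  ·-⊕-++ zero    ab≡d y c = refl
  ·-⊕-++ (suc m) ab≡d y c = cong₂ _∷_ (trans (+-identityʳ _) ab≡d) (·-⊕-++ m ab≡d y c)

  negated-unit-factor-nonzero : ∀ {a b} → b * a ≡ - 1# → b ≢ 0#
  negated-unit-factor-nonzero {a} ba≡-1 b≡0 = -1≢0 (trans (sym ba≡-1) (trans (cong (_* a) b≡0) (zeroˡ a)))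

  encode-· : ∀ {k n} (G : GenMatrix F k n) a u → encode G (a · u) ≡ a · encode G u
  encode-· []      a []      = sym (·-0v a)
  encode-· (g ∷ G) a (b ∷ u) = begin
    (a * b) · g ⊕ encode G (a · u) ≡⟨ cong₂ _⊕_ (sym (·-· a b g)) (encode-· G a u) ⟩
    a · b · g ⊕ a · encode G u     ≡⟨ ·-distrib-⊕ a (b · g) (encode G u) ⟨
    a · (b · g ⊕ encode G u)       ∎
    where open ≡-Reasoning

  encode-⊖ : ∀ {k n} (G : GenMatrix F k n) u v → encode G (u ⊖ v) ≡ encode G u ⊖ encode G v
  encode-⊖ []      []      []      = sym (v⊖v≡0v 0v)
  encode-⊖ (g ∷ G) (a ∷ u) (b ∷ v) = begin
    (a +ᶠ - b) · g ⊕ encode G (u ⊖ v)              ≡⟨ cong ((a +ᶠ - b) · g ⊕_) (encode-⊖ G u v) ⟩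
    (a +ᶠ - b) · g ⊕ (encode G u ⊖ encode G v)     ≡⟨ ·⊕⊖-interchange a b g (encode G u) (encode G v) ⟩
    (a · g ⊕ encode G u) ⊖ (b · g ⊕ encode G v)    ∎
    where open ≡-Reasoning

  encode-injective : ∀ {n k} (C : LinearCode F n k) → Injective _≡_ _≡_ (encode (gen C))
  encode-injective C {u} {v} eq = u⊖v≡0⇒u≡v u v (indep C (u ⊖ v) (begin
    encode (gen C) (u ⊖ v)                    ≡⟨ encode-⊖ (gen C) u v ⟩
    encode (gen C) u ⊖ encode (gen C) v     ≡⟨ cong (_⊖ encode (gen C) v) eq ⟩
    encode (gen C) v ⊖ encode (gen C) v     ≡⟨ v⊖v≡0v (encode (gen C) v) ⟩
    0v                                          ∎))
    where open ≡-Reasoning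

  wt-++ : ∀ {m n} (u : Word F m) (v : Word F n) → wt (u ++ v) ≡ wt u + wt v
  wt-++ []      v = refl
  wt-++ (a ∷ u) v = trans (cong (_ +_) (wt-++ u v)) (sym (NP.+-assoc _ (wt u) (wt v)))

  wt-∷-zero : ∀ {n a} → a ≡ 0# → (v : Word F n) → wt (a ∷ v) ≡ wt v
  wt-∷-zero {a = a} a≡0 v = count (a ≟ 0#)
    where
    count : (d : Dec (a ≡ 0#)) → (if does d then 0 else 1) + wt v ≡ wt v
    count (yes _)  = refl
    count (no a≢0) = ⊥-elim (a≢0 a≡0)

  wt-∷-nonzero : ∀ {n a} → a ≢ 0# → (v : Word F n) → wt (a ∷ v) ≡ suc (wt v)
  wt-∷-nonzero {a = a} a≢0 v = count (a ≟ 0#)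
    where
    count : (d : Dec (a ≡ 0#)) → (if does d then 0 else 1) + wt v ≡ suc (wt v)
    count (yes a≡0) = ⊥-elim (a≢0 a≡0)
    count (no _)    = refl

  wt-replicate : ∀ m {a} → a ≢ 0# → wt (replicate m a) ≡ m
  wt-replicate zero    a≢0 = refl
  wt-replicate (suc m) a≢0 = trans (wt-∷-nonzero a≢0 (replicate m _)) (cong suc (wt-replicate m a≢0))

  wt-0v : ∀ {n} → wt (0v {n}) ≡ 0
  wt-0v {zero}  = refl
  wt-0v {suc n} = trans (wt-∷-zero refl (0v {n})) (wt-0v {n})

  wt-· : ∀ {n b} → b ≢ 0# → (v : Word F n) → wt (b · v) ≡ wt v
  wt-·         b≢0 []      = refl
  wt-· {b = b} b≢0 (a ∷ v) with a ≟ 0#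
  ... | yes a≡0 = begin
    wt (b * a ∷ b · v) ≡⟨ wt-∷-zero (trans (cong (b *_) a≡0) (zeroʳ b)) (b · v) ⟩
    wt (b · v)         ≡⟨ wt-· b≢0 v ⟩
    wt v               ≡⟨ wt-∷-zero a≡0 v ⟨
    wt (a ∷ v)         ∎
    where open ≡-Reasoning
  ... | no a≢0 = begin
    wt (b * a ∷ b · v) ≡⟨ wt-∷-nonzero (*-nonzero b≢0 a≢0) (b · v) ⟩
    suc (wt (b · v))   ≡⟨ cong suc (wt-· b≢0 v) ⟩
    suc (wt v)         ≡⟨ wt-∷-nonzero a≢0 v ⟨
    wt (a ∷ v)         ∎
    where open ≡-Reasoning

  wt≤length : ∀ {n} (v : Word F n) → wt v ≤ n
  wt≤length []      = z≤n
  wt≤length (a ∷ v) with a ≟ 0#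
  ... | yes a≡0 = NP.≤-trans (NP.≤-reflexive (wt-∷-zero a≡0 v)) (NP.m≤n⇒m≤1+n (wt≤length v))
  ... | no  a≢0 = NP.≤-trans (NP.≤-reflexive (wt-∷-nonzero a≢0 v)) (s≤s (wt≤length v))

  module Extension {n k} (C : LinearCode F n k) (x : Word F n) where

    G : GenMatrix F k n
    G = gen C

    pad : Word F n → Word F (suc n + n)
    pad g = replicate (suc n) 0# ++ g

    G⁺ : GenMatrix F (suc k) (suc n + n)
    G⁺ = (replicate (suc n) 1# ++ x) ∷ map pad G

    encode-map-pad : ∀ {j} (H : GenMatrix F j n) u → encode (map pad H) u ≡ pad (encode H u)
    encode-map-pad []      []      = replicate-+ (suc n) n 0#
    encode-map-pad (h ∷ H) (b ∷ u) = begin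
      b · pad h ⊕ encode (map pad H) u ≡⟨ cong (b · pad h ⊕_) (encode-map-pad H u) ⟩
      b · pad h ⊕ pad (encode H u)     ≡⟨ ·-⊕-++ (suc n) (zeroʳ b) h (encode H u) ⟩
      pad (b · h ⊕ encode H u)         ∎
      where open ≡-Reasoning

    encode-G⁺ : ∀ a u → encode G⁺ (a ∷ u) ≡ replicate (suc n) a ++ (a · x ⊕ encode G u)
    encode-G⁺ a u = begin
      a · (replicate (suc n) 1# ++ x) ⊕ encode (map pad G) u ≡⟨ cong (a · (replicate (suc n) 1# ++ x) ⊕_) (encode-map-pad G u) ⟩
      a · (replicate (suc n) 1# ++ x) ⊕ pad (encode G u)     ≡⟨ ·-⊕-++ (suc n) (*-identityʳ a) x (encode G u) ⟩
      replicate (suc n) a ++ (a · x ⊕ encode G u)            ∎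
      where open ≡-Reasoning

    G⁺-independent : LinIndep F G⁺
    G⁺-independent (a ∷ u) eq with VP.∷-injectiveˡ (trans (sym (encode-G⁺ a u)) eq)
    ... | refl = cong (0# ∷_) (indep C u (begin
      encode G u            ≡⟨ 0·x⊕v≡v x (encode G u) ⟨
      0# · x ⊕ encode G u   ≡⟨ VP.++-injectiveʳ (replicate (suc n) 0#) (replicate (suc n) 0#) tail-eq ⟩
      0v                    ∎))
      where
      open ≡-Reasoning
      tail-eq : replicate (suc n) 0# ++ (0# · x ⊕ encode G u) ≡ replicate (suc n) 0# ++ 0v
      tail-eq = trans (sym (encode-G⁺ 0# u)) (trans eq (replicate-+ (suc n) n 0#))

    C⁺ : LinearCode F (suc n + n) (suc k)
    C⁺ = record { gen = G⁺ ; indep = G⁺-independent }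

    wt-G⁺ : ∀ a u → wt (encode G⁺ (a ∷ u)) ≡ wt (replicate (suc n) a) + wt (a · x ⊕ encode G u)
    wt-G⁺ a u = trans (cong wt (encode-G⁺ a u)) (wt-++ (replicate (suc n) a) (a · x ⊕ encode G u))

    wt-G⁺-zero : ∀ u → wt (encode G⁺ (0# ∷ u)) ≡ wt (encode G u)
    wt-G⁺-zero u = begin
      wt (encode G⁺ (0# ∷ u))                             ≡⟨ wt-G⁺ 0# u ⟩
      wt (0v {suc n}) + wt (0# · x ⊕ encode G u)           ≡⟨ cong₂ _+_ (wt-0v {suc n}) (cong wt (0·x⊕v≡v x (encode G u))) ⟩
      wt (encode G u)                                     ∎
      where open ≡-Reasoning

    wt-G⁺-nonzero : ∀ {a b} → a ≢ 0# → b * a ≡ - 1# → ∀ u →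
                    wt (encode G⁺ (a ∷ u)) ≡ suc n + dist F (b · encode G u) x
    wt-G⁺-nonzero {a} {b} a≢0 ba≡-1 u = begin
      wt (encode G⁺ (a ∷ u))                               ≡⟨ wt-G⁺ a u ⟩
      wt (replicate (suc n) a) + wt (a · x ⊕ encode G u)   ≡⟨ cong₂ _+_ (wt-replicate (suc n) a≢0) (sym (wt-· (negated-unit-factor-nonzero ba≡-1) (a · x ⊕ encode G u))) ⟩
      suc n + wt (b · (a · x ⊕ encode G u))                ≡⟨ cong (λ v → suc n + wt v) (·-⊕-normalise ba≡-1 x (encode G u)) ⟩
      suc n + dist F (b · encode G u) x                    ∎
      where open ≡-Reasoning

    ShiftedDistance : ℕ → Set
    ShiftedDistance w = ∃ λ c → _∈C_ F c C × suc n + dist F c x ≡ w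

    weight-of-C⁺⇒old-or-shifted : ∀ {w} → IsWeightOf F C⁺ w → IsWeightOf F C w ⊎ ShiftedDistance w
    weight-of-C⁺⇒old-or-shifted (_ , (a ∷ u , refl) , wt≡w) with a ≟ 0#
    ... | yes refl = inj₁ (encode G u , (u , refl) , trans (sym (wt-G⁺-zero u)) wt≡w)
    ... | no a≢0 with inverse-of-negation a≢0
    ...   | b , ba≡-1 =
      inj₂ (b · encode G u , (b · u , encode-· G b u) , trans (sym (wt-G⁺-nonzero a≢0 ba≡-1 u)) wt≡w)

    old-or-shifted⇒weight-of-C⁺ : ∀ {w} → IsWeightOf F C w ⊎ ShiftedDistance w → IsWeightOf F C⁺ w
    old-or-shifted⇒weight-of-C⁺ (inj₁ (_ , (u , refl) , wt≡w)) =
      encode G⁺ (0# ∷ u) , (0# ∷ u , refl) , trans (wt-G⁺-zero u) wt≡w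
    old-or-shifted⇒weight-of-C⁺ (inj₂ (_ , (u , refl) , d≡w)) =
      encode G⁺ (- 1# ∷ u) , (- 1# ∷ u , refl) ,
      trans (wt-G⁺-nonzero -1≢0 (*-identityˡ (- 1#)) u)
            (trans (cong (λ c → suc n + dist F c x) (1·v≡v (encode G u))) d≡w)

    old-and-shifted-disjoint : ∀ w → IsWeightOf F C w → ¬ ShiftedDistance w
    old-and-shifted-disjoint w (c , _ , refl) (_ , _ , d≡w) =
      NP.1+n≰n (NP.m+n≤o⇒m≤o (suc n) (subst (_≤ n) (sym d≡w) (wt≤length c)))

    ShiftedDistance-size : (∀ c c′ → _∈C_ F c C → _∈C_ F c′ C → dist F c x ≡ dist F c′ x → c ≡ c′) →
                           HasSize ShiftedDistance (q ^ k)
    ShiftedDistance-size distinct =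
      HasSize-via (Fin^↔Vec enum k) shifted shifted-injective (λ u → encode G u , (u , refl) , refl) onto
      where
      shifted : Word F k → ℕ
      shifted u = suc n + dist F (encode G u) x
      shifted-injective : Injective _≡_ _≡_ shifted
      shifted-injective {u} {v} eq =
        encode-injective C (distinct _ _ (u , refl) (v , refl) (NP.+-cancelˡ-≡ (suc n) _ _ eq))
      onto : ∀ w → ShiftedDistance w → ∃ λ u → shifted u ≡ w
      onto w (_ , (u , refl) , d≡w) = u , d≡w

    size-of-C⁺ : ∀ {s} → HasSize (IsWeightOf F C) s →
                (∀ c c′ → _∈C_ F c C → _∈C_ F c′ C → dist F c x ≡ dist F c′ x → c ≡ c′) →
                HasSize (IsWeightOf F C⁺) (s + q ^ k)
    size-of-C⁺ sizeC distinct =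
      HasSize-resp old-or-shifted⇒weight-of-C⁺ weight-of-C⁺⇒old-or-shifted
        (HasSize-⊎ old-and-shifted-disjoint sizeC (ShiftedDistance-size distinct))

field-size≥2 : ∀ {q} → FiniteField q → 2 ≤ q
field-size≥2 F = FP.injective⇒≤ from-0#-1#-injective
  where
  open FiniteField F
  open Inverse enum using (from)

  from-injective : Injective _≡_ _≡_ from
  from-injective = Injection.injective (↔⇒↣ (↔-sym enum))

  from-0#-1# : Fin 2 → Fin _
  from-0#-1# Fin.zero           = from 0#
  from-0#-1# (Fin.suc Fin.zero) = from 1#

  from-0#-1#-injective : Injective _≡_ _≡_ from-0#-1#
  from-0#-1#-injective {Fin.zero}           {Fin.zero}           _  = refl
  from-0#-1#-injective {Fin.zero}           {Fin.suc Fin.zero}   eq = ⊥-elim (0≢1 (from-injective eq))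
  from-0#-1#-injective {Fin.suc Fin.zero}   {Fin.zero}           eq = ⊥-elim (0≢1 (from-injective (sym eq)))
  from-0#-1#-injective {Fin.suc Fin.zero}   {Fin.suc Fin.zero}   _  = refl

θ-suc : ∀ {q} → 2 ≤ q → ∀ k → θ q (suc k) ≡ θ q k + q ^ k
-- q^(k+1) unfolds to q^k + (q − 1) q^k, and q − 1 divides the second summand.
θ-suc {suc (suc r)} (s≤s (s≤s z≤n)) k = begin
  (Q ^ k + suc r ℕ.* Q ^ k ∸ 1) / suc r ≡⟨ cong (_/ suc r) (NP.+-∸-comm (suc r ℕ.* Q ^ k) (NP.m^n>0 Q k)) ⟩
  (Q ^ k ∸ 1 + suc r ℕ.* Q ^ k) / suc r ≡⟨ +-distrib-/-∣ʳ (Q ^ k ∸ 1) (m∣m*n (Q ^ k)) ⟩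
  θ Q k + suc r ℕ.* Q ^ k / suc r       ≡⟨ cong (θ Q k +_) (trans (cong (_/ suc r) (NP.*-comm (suc r) (Q ^ k)))
                                                                  (m*n/n≡m (Q ^ k) (suc r))) ⟩
  θ Q k + Q ^ k                         ∎
  where
  open ≡-Reasoning
  Q : ℕ
  Q = suc (suc r)

lemma1 : (q : ℕ) (F : FiniteField q) (n k : ℕ) → k ≥ 1 →
           (C : LinearCode F n k) →
           HasSize (IsWeightOf F C) (θ q k + 1) →
           (∃ λ (x : Word F n) → ¬ (_∈C_ F x C) ×
              (∀ c c′ → _∈C_ F c C → _∈C_ F c′ C →
                 dist F c x ≡ dist F c′ x → c ≡ c′)) →
           ∃ λ (n′ : ℕ) → ∃ λ (D : LinearCode F n′ (k + 1)) →
             HasSize (IsWeightOf F D) (θ q (k + 1) + 1)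
lemma1 q F n k _ C sizeC (x , _ , distinct) rewrite NP.+-comm k 1 =
  suc n + n , C⁺ , subst (HasSize (IsWeightOf F C⁺)) size-eq (size-of-C⁺ sizeC distinct)
  where
  open Extension F C x
  size-eq : θ q k + 1 + q ^ k ≡ θ q (suc k) + 1
  size-eq = trans (xy∙z≈xz∙y (θ q k) 1 (q ^ k)) (cong (_+ 1) (sym (θ-suc (field-size≥2 F) k)))
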